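{- Let $\mathbf{X}_2^+$ be the free semigroup on two generators, i.e., the set of nonempty words over a two-letter alphabet with the operation of concatenation. Then for every $n\in\mathbb{N}_+$, $s^{\mathrm{ac}}_n(\mathbf{X}_2^+)=n!$.
   Context: A groupoid is a nonempty set $G$ with a binary operation $*$. For $X_n=\{x_1,\dots,x_n\}$, groupoid terms over $X_n$ are built recursively: each variable is a term, and if $s,t$ are terms then $(st)$ is a term. A full linear term over $X_n$ is a term in which each of $x_1,\dots,x_n$ occurs exactly once. Each term $t$ over $X_n$ induces an $n$-ary term operation $t^{\mathbf{G}}\colon G^n\to G$ by interpreting juxtaposition as $*$. The ac-spectrum $s^{\mathrm{ac}}_n(\mathbf{G})$ is the number of distinct term operations on $\mathbf{G}$ induced by full linear terms over $X_n$. -}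

module Defs where

open import Data.Nat using (ℕ; zero; suc; _+_)
open import Data.Fin using (Fin; _≟_)
open import Data.Bool using (Bool)
open import Data.List.NonEmpty using (List⁺; _⁺++⁺_)
open import Data.Product using (Σ; ∃; _×_)
open import Relation.Nullary using (¬_; yes; no)
open import Relation.Binary.PropositionalEquality using (_≡_)

data Term (n : ℕ) : Set where
  var : Fin n → Term n
  _·_ : Term n → Term n → Term n

occ : {n : ℕ} → Fin n → Term n → ℕ
occ i (var j) with i ≟ j
... | yes _ = 1
... | no _  = 0
occ i (s · t) = occ i s + occ i t

IsFullLinear : {n : ℕ} → Term n → Set
IsFullLinear {n} t = (i : Fin n) → occ i t ≡ 1

FullLinearTerm : ℕ → Set
FullLinearTerm n = Σ (Term n) IsFullLinear

⟦_⟧ : {G : Set} {n : ℕ} → Term n → (G → G → G) → (Fin n → G) → G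
⟦ var i ⟧ _*_ a = a i
⟦ s · t ⟧ _*_ a = _*_ (⟦ s ⟧ _*_ a) (⟦ t ⟧ _*_ a)

SameOp : {G : Set} {n : ℕ} → (G → G → G) → Term n → Term n → Set
SameOp {G} {n} _*_ s t = (a : Fin n → G) → ⟦ s ⟧ _*_ a ≡ ⟦ t ⟧ _*_ a

-- s^ac_n(G) = k : the set of term operations induced by full linear terms over X_n
-- has exactly k elements, witnessed by an enumeration Fin k → full linear terms
-- whose induced operations are pairwise distinct and which covers every induced operation.
ACSpectrumIs : {G : Set} → (G → G → G) → ℕ → ℕ → Set
ACSpectrumIs {G} _*_ n k =
  Σ (Fin k → FullLinearTerm n) λ f →
    ((i j : Fin k) → SameOp _*_ (Σ.proj₁ (f i)) (Σ.proj₁ (f j)) → i ≡ j)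
    × ((t : FullLinearTerm n) → ∃ λ i → SameOp _*_ (Σ.proj₁ t) (Σ.proj₁ (f i)))

X₂⁺ : Set
X₂⁺ = List⁺ Bool

concat : X₂⁺ → X₂⁺ → X₂⁺
concat = _⁺++⁺_

-- A term operation of the free semigroup depends only on the sequence of variables read off the
-- leaves of the term, and that sequence is recovered from the value at the substitution
-- x_i ↦ 1^i 0. So two full linear terms induce the same operation iff their leaf sequences
-- coincide, and the leaf sequences of full linear terms are exactly the n! arrangements of X_n.
module Submission where

open import Defs
open import Data.Nat using (ℕ; zero; suc; _+_; _*_; _≤_; _!)
open import Data.Nat.Properties using (suc-injective)
open import Data.Fin using (Fin; punchIn; punchOut; remQuot; combine; toℕ)
open import Data.Fin.Properties
  using (_≟_; toℕ-injective; punchIn-injective; punchInᵢ≢i; punchIn-punchOut;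
         remQuot-combine; combine-remQuot)
open import Data.Bool using (Bool; true; false)
open import Data.List using (List; []; _∷_; _++_; map; concatMap)
open import Data.List.Properties using (++-identityʳ; ∷-injective; map-injective; ++-assoc; concatMap-map)
open import Data.List.NonEmpty using (List⁺; toList; head; tail) renaming (_∷_ to _∷⁺_)
open import Data.Product using (∃; ∃₂; _×_; _,_; proj₁; uncurry)
open import Function using (_∘_)
open import Function.Definitions using (Injective)
open import Relation.Nullary using (yes; no)
open import Relation.Binary.PropositionalEquality
  using (_≡_; _≢_; refl; sym; trans; cong; cong₂; ≢-sym; module ≡-Reasoning)
open import Data.Empty using (⊥-elim)

count : {n : ℕ} → Fin n → List (Fin n) → ℕ
count i [] = 0
count i (x ∷ xs) with i ≟ x
... | yes _ = suc (count i xs)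
... | no _  = count i xs

count-here : {n : ℕ} (i : Fin n) (xs : List (Fin n)) → count i (i ∷ xs) ≡ suc (count i xs)
count-here i xs with i ≟ i
... | yes _  = refl
... | no i≢i = ⊥-elim (i≢i refl)

count-there : {n : ℕ} {i x : Fin n} (xs : List (Fin n)) → i ≢ x → count i (x ∷ xs) ≡ count i xs
count-there {i = i} {x} xs i≢x with i ≟ x
... | yes i≡x = ⊥-elim (i≢x i≡x)
... | no _    = refl

count-++ : {n : ℕ} (i : Fin n) (xs ys : List (Fin n)) → count i (xs ++ ys) ≡ count i xs + count i ys
count-++ i [] ys = refl
count-++ i (x ∷ xs) ys with i ≟ x
... | yes _ = cong suc (count-++ i xs ys)
... | no _  = count-++ i xs ys

count-map-injective : {m n : ℕ} {f : Fin m → Fin n} → Injective _≡_ _≡_ f →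
                      (i : Fin m) (xs : List (Fin m)) → count (f i) (map f xs) ≡ count i xs
count-map-injective f-inj i [] = refl
count-map-injective {f = f} f-inj i (x ∷ xs) with f i ≟ f x | i ≟ x
... | yes _    | yes _   = cong suc (count-map-injective f-inj i xs)
... | no _     | no _    = count-map-injective f-inj i xs
... | yes fi≡fx | no i≢x = ⊥-elim (i≢x (f-inj fi≡fx))
... | no fi≢fx | yes i≡x = ⊥-elim (fi≢fx (cong f i≡x))

count-map-punchIn-self : {n : ℕ} (k : Fin (suc n)) (xs : List (Fin n)) → count k (map (punchIn k) xs) ≡ 0
count-map-punchIn-self k [] = refl
count-map-punchIn-self k (x ∷ xs) =
  trans (count-there _ (≢-sym (punchInᵢ≢i k x))) (count-map-punchIn-self k xs)

count≡0⇒map-punchIn : {n : ℕ} (k : Fin (suc n)) (xs : List (Fin (suc n))) →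
                      count k xs ≡ 0 → ∃ λ ys → map (punchIn k) ys ≡ xs
count≡0⇒map-punchIn k [] _ = [] , refl
count≡0⇒map-punchIn k (x ∷ xs) k∉ with k ≟ x
... | no k≢x with count≡0⇒map-punchIn k xs k∉
...   | ys , eq = punchOut k≢x ∷ ys , cong₂ _∷_ (punchIn-punchOut k≢x) eq

Linear : {n : ℕ} → List (Fin n) → Set
Linear {n} xs = (i : Fin n) → count i xs ≡ 1

prependFresh : {n : ℕ} → Fin (suc n) → List (Fin n) → List⁺ (Fin (suc n))
prependFresh k xs = k ∷⁺ map (punchIn k) xs

prependFresh-linear : {n : ℕ} (k : Fin (suc n)) {xs : List (Fin n)} →
                      Linear xs → Linear (toList (prependFresh k xs))
prependFresh-linear k {xs} lin i with i ≟ k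
... | yes refl = cong suc (count-map-punchIn-self k xs)
... | no i≢k = begin
  count i (map (punchIn k) xs)                              ≡⟨ cong (λ j → count j (map (punchIn k) xs)) (punchIn-punchOut k≢i) ⟨
  count (punchIn k (punchOut k≢i)) (map (punchIn k) xs)     ≡⟨ count-map-injective (punchIn-injective k _ _) _ xs ⟩
  count (punchOut k≢i) xs                                   ≡⟨ lin _ ⟩
  1                                                         ∎
  where
  open ≡-Reasoning
  k≢i = ≢-sym i≢k

prependFresh-injective : {n : ℕ} {k l : Fin (suc n)} {xs ys : List (Fin n)} →
                         toList (prependFresh k xs) ≡ toList (prependFresh l ys) → k ≡ l × xs ≡ ys
prependFresh-injective eq with ∷-injective eq
... | refl , tails = refl , map-injective (punchIn-injective _ _ _) tails

linear⇒prependFresh : {n : ℕ} (xs : List (Fin (suc n))) → Linear xs →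
                      ∃₂ λ k ys → Linear ys × toList (prependFresh k ys) ≡ xs
linear⇒prependFresh [] lin with lin Fin.zero
... | ()
linear⇒prependFresh (k ∷ xs) lin with count≡0⇒map-punchIn k xs (suc-injective (trans (sym (count-here k xs)) (lin k)))
... | ys , refl = k , ys , ys-linear , refl
  where
  ys-linear : Linear ys
  ys-linear i = begin
    count i ys                                          ≡⟨ count-map-injective (punchIn-injective k _ _) i ys ⟨
    count (punchIn k i) (map (punchIn k) ys)            ≡⟨ count-there _ (punchInᵢ≢i k i) ⟨
    count (punchIn k i) (k ∷ map (punchIn k) ys)        ≡⟨ lin (punchIn k i) ⟩
    1                                                   ∎
    where open ≡-Reasoning

-- Index j : Fin ((n+1)!) splits as (k , j') : Fin (n+1) × Fin (n!); k is the head of the arrangement.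
arrangement : (n : ℕ) → Fin (n !) → List (Fin n)
arrangement⁺ : (n : ℕ) → Fin (suc n !) → List⁺ (Fin (suc n))

arrangement zero    _ = []
arrangement (suc n) j = toList (arrangement⁺ n j)

arrangement⁺ n j = uncurry (λ k j′ → prependFresh k (arrangement n j′)) (remQuot (n !) j)

arrangement⁺-combine : (n : ℕ) (k : Fin (suc n)) (j : Fin (n !)) →
                       arrangement⁺ n (combine k j) ≡ prependFresh k (arrangement n j)
arrangement⁺-combine n k j = cong (uncurry (λ k j′ → prependFresh k (arrangement n j′))) (remQuot-combine k j)

arrangement-linear : (n : ℕ) (j : Fin (n !)) → Linear (arrangement n j)
arrangement-linear zero    _ ()
arrangement-linear (suc n) j = prependFresh-linear _ (arrangement-linear n _)

remQuot-injective : {m n : ℕ} {i j : Fin (m * n)} → remQuot {m} n i ≡ remQuot n j → i ≡ j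
remQuot-injective {m} {n} {i} {j} eq =
  trans (sym (combine-remQuot {m} n i)) (trans (cong (uncurry combine) eq) (combine-remQuot {m} n j))

arrangement-injective : (n : ℕ) {i j : Fin (n !)} → arrangement n i ≡ arrangement n j → i ≡ j
arrangement-injective zero {Fin.zero} {Fin.zero} _ = refl
arrangement-injective (suc n) eq with prependFresh-injective eq
... | heads , tails = remQuot-injective {suc n} (cong₂ _,_ heads (arrangement-injective n tails))

arrangement-surjective : (n : ℕ) (xs : List (Fin n)) → Linear xs → ∃ λ j → arrangement n j ≡ xs
arrangement-surjective zero [] _ = Fin.zero , refl
arrangement-surjective zero (() ∷ _) _
arrangement-surjective (suc n) xs lin with linear⇒prependFresh xs lin
... | k , ys , ys-linear , refl with arrangement-surjective n ys ys-linear
...   | j , refl = combine k j , cong toList (arrangement⁺-combine n k j)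

leaves : {n : ℕ} → Term n → List (Fin n)
leaves (var i) = i ∷ []
leaves (s · t) = leaves s ++ leaves t

occ≡count-leaves : {n : ℕ} (i : Fin n) (t : Term n) → occ i t ≡ count i (leaves t)
occ≡count-leaves i (var j) with i ≟ j
... | yes _ = refl
... | no _  = refl
occ≡count-leaves i (s · t) =
  trans (cong₂ _+_ (occ≡count-leaves i s) (occ≡count-leaves i t)) (sym (count-++ i (leaves s) (leaves t)))

rightComb : {n : ℕ} → Fin n → List (Fin n) → Term n
rightComb x []       = var x
rightComb x (y ∷ ys) = var x · rightComb y ys

leaves-rightComb : {n : ℕ} (x : Fin n) (xs : List (Fin n)) → leaves (rightComb x xs) ≡ x ∷ xs
leaves-rightComb x []       = refl
leaves-rightComb x (y ∷ ys) = cong (x ∷_) (leaves-rightComb y ys)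

concatMap-++ : {A B : Set} (f : A → List B) (xs ys : List A) →
               concatMap f (xs ++ ys) ≡ concatMap f xs ++ concatMap f ys
concatMap-++ f []       ys = refl
concatMap-++ f (x ∷ xs) ys =
  trans (cong (f x ++_) (concatMap-++ f xs ys)) (sym (++-assoc (f x) (concatMap f xs) (concatMap f ys)))

⟦⟧-concat : {n : ℕ} (t : Term n) (a : Fin n → X₂⁺) →
            toList (⟦ t ⟧ concat a) ≡ concatMap (toList ∘ a) (leaves t)
⟦⟧-concat (var i) a = sym (++-identityʳ (toList (a i)))
⟦⟧-concat (s · t) a = begin
  toList (⟦ s ⟧ concat a) ++ toList (⟦ t ⟧ concat a)                     ≡⟨ cong₂ _++_ (⟦⟧-concat s a) (⟦⟧-concat t a) ⟩
  concatMap (toList ∘ a) (leaves s) ++ concatMap (toList ∘ a) (leaves t) ≡⟨ concatMap-++ (toList ∘ a) (leaves s) (leaves t) ⟨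
  concatMap (toList ∘ a) (leaves s ++ leaves t)                          ∎
  where open ≡-Reasoning

toList-injective : {A : Set} {u v : List⁺ A} → toList u ≡ toList v → u ≡ v
toList-injective {u = _ ∷⁺ _} {_ ∷⁺ _} refl = refl

leaves-≡⇒sameOp-concat : {n : ℕ} (s t : Term n) → leaves s ≡ leaves t → SameOp concat s t
leaves-≡⇒sameOp-concat s t eq a = toList-injective (begin
  toList (⟦ s ⟧ concat a)              ≡⟨ ⟦⟧-concat s a ⟩
  concatMap (toList ∘ a) (leaves s)    ≡⟨ cong (concatMap (toList ∘ a)) eq ⟩
  concatMap (toList ∘ a) (leaves t)    ≡⟨ ⟦⟧-concat t a ⟨
  toList (⟦ t ⟧ concat a)              ∎)
  where open ≡-Reasoning

-- The prefix code k ↦ 1^k 0; decode inverts it on concatenations of codewords.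
unary : ℕ → X₂⁺
unary zero    = false ∷⁺ []
unary (suc k) = true ∷⁺ toList (unary k)

decode : List Bool → List ℕ
decode []           = []
decode (false ∷ bs) = 0 ∷ decode bs
decode (true ∷ bs)  with decode bs
... | []     = []
... | k ∷ ks = suc k ∷ ks

decode-unary-++ : (k : ℕ) (bs : List Bool) → decode (toList (unary k) ++ bs) ≡ k ∷ decode bs
decode-unary-++ zero    bs = refl
decode-unary-++ (suc k) bs rewrite decode-unary-++ k bs = refl

decode-concatMap-unary : (ks : List ℕ) → decode (concatMap (toList ∘ unary) ks) ≡ ks
decode-concatMap-unary []       = refl
decode-concatMap-unary (k ∷ ks) =
  trans (decode-unary-++ k _) (cong (k ∷_) (decode-concatMap-unary ks))

sameOp-concat⇒leaves-≡ : {n : ℕ} (s t : Term n) → SameOp concat s t → leaves s ≡ leaves t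
sameOp-concat⇒leaves-≡ s t same = map-injective toℕ-injective (begin
  map toℕ (leaves s)                                          ≡⟨ decode-concatMap-unary _ ⟨
  decode (concatMap (toList ∘ unary) (map toℕ (leaves s)))    ≡⟨ cong decode (value-at-code s) ⟩
  decode (toList (⟦ s ⟧ concat code))                         ≡⟨ cong (decode ∘ toList) (same code) ⟩
  decode (toList (⟦ t ⟧ concat code))                         ≡⟨ cong decode (value-at-code t) ⟨
  decode (concatMap (toList ∘ unary) (map toℕ (leaves t)))    ≡⟨ decode-concatMap-unary _ ⟩
  map toℕ (leaves t)                                          ∎)
  where
  open ≡-Reasoning
  code : Fin _ → X₂⁺
  code = unary ∘ toℕ
  value-at-code : (u : Term _) → concatMap (toList ∘ unary) (map toℕ (leaves u)) ≡ toList (⟦ u ⟧ concat code)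
  value-at-code u = trans (concatMap-map (toList ∘ unary) toℕ (leaves u)) (sym (⟦⟧-concat u code))

proposition3p2 : (n : ℕ) → 1 ≤ n → ACSpectrumIs concat n (n !)
proposition3p2 (suc n) _ = enumeration , injective , covering
  where
  term : Fin (suc n !) → Term (suc n)
  term j = rightComb (head (arrangement⁺ n j)) (tail (arrangement⁺ n j))

  leaves-term : (j : Fin (suc n !)) → leaves (term j) ≡ arrangement (suc n) j
  leaves-term j = leaves-rightComb _ _

  enumeration : Fin (suc n !) → FullLinearTerm (suc n)
  enumeration j = term j , λ i →
    trans (occ≡count-leaves i (term j)) (trans (cong (count i) (leaves-term j)) (arrangement-linear (suc n) j i))

  injective : (i j : Fin (suc n !)) → SameOp concat (term i) (term j) → i ≡ j
  injective i j same = arrangement-injective (suc n)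
    (trans (sym (leaves-term i)) (trans (sameOp-concat⇒leaves-≡ (term i) (term j) same) (leaves-term j)))

  covering : (t : FullLinearTerm (suc n)) → ∃ λ j → SameOp concat (proj₁ t) (term j)
  covering (t , full) with arrangement-surjective (suc n) (leaves t) (λ i → trans (sym (occ≡count-leaves i t)) (full i))
  ... | j , eq = j , leaves-≡⇒sameOp-concat t (term j) (trans (sym eq) (sym (leaves-term j)))
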